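{- Let $m\ge1$, $p\ge1$, and let $\mathbf{u}=\lim_{k\to\infty}\varphi^k(0)$ be the fixed point of the substitution $\varphi$ on the alphabet $\{0,1,\dots,m+p-1\}$ given by $\varphi(\ell)=0^{\alpha_\ell}(\ell+1)$ for $0\le\ell\le m+p-2$ and $\varphi(m+p-1)=0^{\alpha_{m+p-1}}m$, where the nonnegative integers $\alpha_0,\dots,\alpha_{m+p-1}$ satisfy the non-simple Parry conditions stated in the context. Let $h'=\min\{\ell\ge m:\alpha_\ell\ge1\}$ and set $$R_{ns}=\begin{cases}h'+p & \text{if }\alpha_0\ge2,\\ h'+m+p-1 & \text{if }\alpha_0=1.\end{cases}$$ Then $\varphi^{R_{ns}}(0)0$ is a prefix of $\mathbf{u}$, and every factor of $\mathbf{u}$ of the form $0t0$, where $t$ is a (possibly empty) word not containing the letter $0$, is a factor of $\varphi^{R_{ns}}(0)0$.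
   Context: Non-simple Parry conditions: the infinite sequence $d=\alpha_0\cdots\alpha_{m-1}(\alpha_m\cdots\alpha_{m+p-1})^\omega$ is the Rényi expansion of $1$ in base a non-simple Parry number, i.e. every proper shift $\alpha_i\alpha_{i+1}\cdots$ ($i\ge1$) of $d$ is lexicographically strictly smaller than $d$, $d$ does not end in $0^\omega$, and $m,p$ are minimal (preperiod and period). These imply $\alpha_0\ge1$, $\alpha_\ell\le\alpha_0$ for all $\ell$, and $\alpha_\ell\ge1$ for some $\ell\in\{m,\dots,m+p-1\}$ (so $h'$ is well defined). $\varphi$ is extended to words as a monoid morphism; $0^a$ denotes $a$ copies of $0$; letters are identified with integers. -}

module Defs where

open import Data.Nat using (ℕ; zero; suc; _+_; _∸_; _≤_; _<_; _<?_; NonZero)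
open import Data.Nat.DivMod using (_%_)
open import Data.List using (List; []; _∷_; _++_; replicate; concatMap; length; lookup)
open import Data.Fin using (Fin)
open import Data.Product using (Σ; ∃; _×_)
open import Relation.Binary.PropositionalEquality using (_≡_; _≢_)
open import Relation.Nullary using (yes; no)

Word : Set
Word = List ℕ

-- The Rényi expansion d = α₀ ⋯ α_{m-1} (α_m ⋯ α_{m+p-1})^ω as a sequence ℕ → ℕ.
-- Only the values α 0, …, α (m+p-1) are used.
dIndex : (m p : ℕ) → .{{NonZero p}} → ℕ → ℕ
dIndex m p n with n <? m
... | yes _ = n
... | no  _ = m + ((n ∸ m) % p)

dSeq : (α : ℕ → ℕ) (m p : ℕ) → .{{NonZero p}} → ℕ → ℕ
dSeq α m p n = α (dIndex m p n)

_<lex_ : (ℕ → ℕ) → (ℕ → ℕ) → Set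
s <lex t = ∃ λ k → (∀ j → j < k → s j ≡ t j) × (s k < t k)

record NonSimpleParry (α : ℕ → ℕ) (m p : ℕ) .{{_ : NonZero p}} : Set where
  field
    shiftsSmaller : ∀ i → 1 ≤ i → (λ n → dSeq α m p (i + n)) <lex dSeq α m p
    notEventuallyZero : ∀ N → ∃ λ n → N ≤ n × dSeq α m p n ≢ 0
    minimal : ∀ m' p' → 1 ≤ p' →
              (∀ n → m' ≤ n → dSeq α m p (n + p') ≡ dSeq α m p n) →
              m ≤ m' × p ≤ p'

-- The substitution φ(ℓ) = 0^{α_ℓ}(ℓ+1) for ℓ ≤ m+p-2, φ(m+p-1) = 0^{α_{m+p-1}} m.
-- (Letters ≥ m+p never occur; their image is irrelevant.)
nextLetter : (m p : ℕ) → ℕ → ℕ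
nextLetter m p ℓ with suc ℓ <? m + p
... | yes _ = suc ℓ
... | no  _ = m

φ : (α : ℕ → ℕ) (m p : ℕ) → ℕ → Word
φ α m p ℓ = replicate (α ℓ) 0 ++ (nextLetter m p ℓ ∷ [])

φ* : (α : ℕ → ℕ) (m p : ℕ) → Word → Word
φ* α m p = concatMap (φ α m p)

φ^ : (α : ℕ → ℕ) (m p : ℕ) → ℕ → Word → Word
φ^ α m p zero    w = w
φ^ α m p (suc k) w = φ* α m p (φ^ α m p k w)

-- n-th letter of a word, with default 0 outside its range
nth : Word → ℕ → ℕ
nth []       _       = 0
nth (x ∷ xs) zero    = x
nth (x ∷ xs) (suc n) = nth xs n

-- The fixed point u = lim φ^k(0), as an infinite word ℕ → ℕ:
-- u_n is the n-th letter of φ^{n+1}(0) (which has length > n+1 under the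
-- Parry conditions, and the φ^k(0) are prefixes of one another).
fixedPoint : (α : ℕ → ℕ) (m p : ℕ) → ℕ → ℕ
fixedPoint α m p n = nth (φ^ α m p (suc n) (0 ∷ [])) n

IsPrefixInf : Word → (ℕ → ℕ) → Set
IsPrefixInf w u = (i : Fin (length w)) → u (Data.Fin.toℕ i) ≡ lookup w i

IsFactorInf : Word → (ℕ → ℕ) → Set
IsFactorInf w u = ∃ λ j → (i : Fin (length w)) → u (j + Data.Fin.toℕ i) ≡ lookup w i

IsFactor : Word → Word → Set
IsFactor w v = ∃ λ x → ∃ λ y → x ++ w ++ y ≡ v

-- R_ns (with α₀ ≥ 1 guaranteed by the Parry conditions)
Rns : (α : ℕ → ℕ) (m p h' : ℕ) → ℕ
Rns α m p h' with α 0
... | suc (suc _) = h' + p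
... | _           = h' + m + p ∸ 1

module Submission where

-- We unfold φ onto the alphabet ℕ: with d = dSeq α m p let ψ(i) = 0^{d_i}(i+1).
-- The folding map π = dIndex m p satisfies π∘ψ = φ∘π, so φ^k(0) = π(X_k) for
-- X_k = ψ^k(0).  The words P_k(j) = ψ^k(j) satisfy P_{k+1}(j) = X_k^{d_j} P_k(j+1).
-- A factor 0t0 of P_k(j) lies inside one of these blocks (induction) or straddles
-- the end of a copy of X_k; then t is the tail of X_k after its last zero and X_k
-- is followed by 0 ('Extends').  Such a tail is 'good' — a word with the same
-- π-image is framed by zeros in X_R 0 — directly when k ≤ R, and when k > R
-- because periodicity of d makes it the π-image of a tail of X_{k-p}.

open import Defs
open import Data.Nat using (ℕ; zero; suc; _+_; _∸_; _≤_; _<_; z≤n; s≤s; NonZero; _<?_; _≤?_; >-nonZero⁻¹)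
open import Data.Nat.Properties
open import Data.Nat.DivMod using (_%_; _/_; m<n⇒m%n≡m; m%n<n; [m+n]%n≡m%n; [m+kn]%n≡m%n; m≡m%n+[m/n]*n; n%n≡0)
open import Data.Nat.Induction using (<-rec)
open import Data.Fin using (Fin; toℕ) renaming (zero to fzero; suc to fsuc)
open import Data.Fin.Properties using (toℕ<n)
open import Data.List using (List; []; _∷_; _++_; replicate; concatMap; length; map; lookup)
open import Data.List.Properties using (++-assoc; ++-identityʳ; ∷-injective; map-++; map-replicate; length-map; length-++; concatMap-++; concatMap-cong; concatMap-map; map-concatMap)
open import Data.List.Relation.Unary.All as All using (All; []; _∷_)
open import Data.List.Relation.Unary.All.Properties using (++⁺; ++⁻ʳ; map⁻)
open import Data.Product using (∃; _×_; _,_; proj₁; proj₂)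
open import Data.Sum using (_⊎_; inj₁; inj₂)
open import Data.Empty using (⊥-elim)
open import Relation.Nullary using (yes; no; ¬_; contradiction)
open import Relation.Binary.PropositionalEquality

pos⇒suc : ∀ {a} → 1 ≤ a → ∃ λ n → a ≡ suc n
pos⇒suc {suc n} _ = n , refl

ZeroFree : Word → Set
ZeroFree = All (_≢ 0)

StartsWith0 : Word → Set
StartsWith0 w = ∃ λ r → w ≡ 0 ∷ r

startsWith0-++ : ∀ u v → StartsWith0 u → StartsWith0 (u ++ v)
startsWith0-++ u v (r , refl) = r ++ v , refl

Framed : Word → Word → Set
Framed t w = ∃ λ x → ∃ λ y → x ++ 0 ∷ t ++ 0 ∷ y ≡ w

framed⇒factor : ∀ t w → Framed t w → IsFactor (0 ∷ t ++ 0 ∷ []) w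
framed⇒factor t w (x , y , e) = x , y , trans (cong (λ z → x ++ 0 ∷ z) (++-assoc t (0 ∷ []) y)) e

factor⇒framed : ∀ t w → IsFactor (0 ∷ t ++ 0 ∷ []) w → Framed t w
factor⇒framed t w (x , y , e) = x , y , trans (cong (λ z → x ++ 0 ∷ z) (sym (++-assoc t (0 ∷ []) y))) e

framed-++ʳ : ∀ {t w} r → Framed t w → Framed t (w ++ r)
framed-++ʳ {t} {w} r (x , y , e) = x , y ++ r , (begin
    x ++ 0 ∷ t ++ 0 ∷ y ++ r     ≡⟨ cong (λ z → x ++ 0 ∷ z) (sym (++-assoc t (0 ∷ y) r)) ⟩
    x ++ (0 ∷ t ++ 0 ∷ y) ++ r   ≡⟨ sym (++-assoc x (0 ∷ t ++ 0 ∷ y) r) ⟩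
    (x ++ 0 ∷ t ++ 0 ∷ y) ++ r   ≡⟨ cong (_++ r) e ⟩
    w ++ r                       ∎)
  where open ≡-Reasoning

framed-++ˡ : ∀ {t w} r → Framed t w → Framed t (r ++ w)
framed-++ˡ r (x , y , e) = r ++ x , y , trans (++-assoc r x _) (cong (r ++_) e)

split-at-zero : ∀ t y A B → t ++ 0 ∷ y ≡ A ++ B →
  (∃ λ y' → t ++ 0 ∷ y' ≡ A) ⊎ (∃ λ t₂ → t ≡ A ++ t₂ × B ≡ t₂ ++ 0 ∷ y)
split-at-zero t y [] B e = inj₂ (t , refl , sym e)
split-at-zero [] y (a ∷ A) B e with ∷-injective e
... | refl , _ = inj₁ (A , refl)
split-at-zero (b ∷ t) y (a ∷ A) B e with ∷-injective e
... | refl , e' with split-at-zero t y A B e'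
...   | inj₁ (y' , e'') = inj₁ (y' , cong (b ∷_) e'')
...   | inj₂ (t₂ , e₁ , e₂) = inj₂ (t₂ , cong (b ∷_) e₁ , e₂)

framed-++-cases : ∀ x t y A B → x ++ 0 ∷ t ++ 0 ∷ y ≡ A ++ B →
  Framed t A ⊎ Framed t B ⊎
  (∃ λ t₁ → ∃ λ t₂ → t ≡ t₁ ++ t₂ × A ≡ x ++ 0 ∷ t₁ × B ≡ t₂ ++ 0 ∷ y)
framed-++-cases x t y [] B e = inj₂ (inj₁ (x , y , e))
framed-++-cases [] t y (a ∷ A) B e with ∷-injective e
... | refl , e' with split-at-zero t y A B e'
...   | inj₁ (y' , e'') = inj₁ ([] , y' , cong (0 ∷_) e'')
...   | inj₂ (t₂ , e₁ , e₂) = inj₂ (inj₂ (A , t₂ , e₁ , refl , e₂))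
framed-++-cases (b ∷ x) t y (a ∷ A) B e with ∷-injective e
... | refl , e' with framed-++-cases x t y A B e'
...   | inj₁ (x' , y' , e'') = inj₁ (b ∷ x' , y' , cong (b ∷_) e'')
...   | inj₂ (inj₁ fr) = inj₂ (inj₁ fr)
...   | inj₂ (inj₂ (t₁ , t₂ , e₁ , e₂ , e₃)) = inj₂ (inj₂ (t₁ , t₂ , e₁ , cong (b ∷_) e₂ , e₃))

framed-¬singleton : ∀ x t y c → x ++ 0 ∷ t ++ 0 ∷ y ≢ c ∷ []
framed-¬singleton [] [] y c ()
framed-¬singleton [] (_ ∷ _) y c ()
framed-¬singleton (_ ∷ []) t y c ()
framed-¬singleton (_ ∷ _ ∷ _) t y c ()

zero-∉-singleton : ∀ t y c → c ≢ 0 → t ++ 0 ∷ y ≢ c ∷ []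
zero-∉-singleton [] y c c≢0 e = c≢0 (sym (proj₁ (∷-injective e)))
zero-∉-singleton (_ ∷ []) y c c≢0 ()
zero-∉-singleton (_ ∷ _ ∷ _) y c c≢0 ()

zeroFree-∌0 : ∀ u v → ¬ ZeroFree (u ++ 0 ∷ v)
zeroFree-∌0 [] v (0≢0 ∷ _) = 0≢0 refl
zeroFree-∌0 (_ ∷ u) v (_ ∷ zf) = zeroFree-∌0 u v zf

zeroFree-or-lastZero : ∀ w → ZeroFree w ⊎ (∃ λ x → ∃ λ t → w ≡ x ++ 0 ∷ t × ZeroFree t)
zeroFree-or-lastZero [] = inj₁ []
zeroFree-or-lastZero (a ∷ w) with zeroFree-or-lastZero w
... | inj₂ (x , t , e , zf) = inj₂ (a ∷ x , t , cong (a ∷_) e , zf)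
... | inj₁ zf with a
...   | zero = inj₂ ([] , w , refl , zf)
...   | suc _ = inj₁ ((λ ()) ∷ zf)

lastZero : ∀ w → StartsWith0 w → ∃ λ x → ∃ λ t → w ≡ x ++ 0 ∷ t × ZeroFree t
lastZero w (r , refl) with zeroFree-or-lastZero (0 ∷ r)
... | inj₁ (0≢0 ∷ _) = ⊥-elim (0≢0 refl)
... | inj₂ split = split

lastZero-unique : ∀ a b a' b' → a ++ 0 ∷ b ≡ a' ++ 0 ∷ b' → ZeroFree b → ZeroFree b' → b ≡ b'
lastZero-unique [] b [] b' e _ _ = proj₂ (∷-injective e)
lastZero-unique [] b (_ ∷ a') b' e zf _ = ⊥-elim (zeroFree-∌0 a' b' (subst ZeroFree (proj₂ (∷-injective e)) zf))
lastZero-unique (_ ∷ a) b [] b' e _ zf' = ⊥-elim (zeroFree-∌0 a b (subst ZeroFree (sym (proj₂ (∷-injective e))) zf'))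
lastZero-unique (_ ∷ a) b (_ ∷ a') b' e zf zf' = lastZero-unique a b a' b' (proj₂ (∷-injective e)) zf zf'

zeroFree-before-leading-0 : ∀ t y r → ZeroFree t → t ++ 0 ∷ y ≡ 0 ∷ r → t ≡ []
zeroFree-before-leading-0 [] y r _ _ = refl
zeroFree-before-leading-0 (_ ∷ _) y r (a≢0 ∷ _) e = ⊥-elim (a≢0 (proj₁ (∷-injective e)))

framed-map : (f : ℕ → ℕ) → f 0 ≡ 0 → ∀ {s w} → Framed s w → Framed (map f s) (map f w)
framed-map f f0 {s} {w} (x , y , e) = map f x , map f y , (begin
    map f x ++ 0 ∷ map f s ++ 0 ∷ map f y       ≡⟨ cong (λ z → map f x ++ z ∷ map f s ++ z ∷ map f y) (sym f0) ⟩
    map f x ++ f 0 ∷ map f s ++ f 0 ∷ map f y   ≡⟨ cong (λ z → map f x ++ f 0 ∷ z) (sym (map-++ f s (0 ∷ y))) ⟩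
    map f x ++ map f (0 ∷ s ++ 0 ∷ y)           ≡⟨ sym (map-++ f x (0 ∷ s ++ 0 ∷ y)) ⟩
    map f (x ++ 0 ∷ s ++ 0 ∷ y)                 ≡⟨ cong (map f) e ⟩
    map f w                                     ∎)
  where open ≡-Reasoning

module _ (f : ℕ → ℕ) (f⁻¹0 : ∀ a → f a ≡ 0 → a ≡ 0) where

  split-at-zero-map⁻ : ∀ V T y → map f V ≡ T ++ 0 ∷ y →
    ∃ λ t → ∃ λ y' → V ≡ t ++ 0 ∷ y' × map f t ≡ T
  split-at-zero-map⁻ (v ∷ V) [] y e = [] , V , cong (_∷ V) (f⁻¹0 v (proj₁ (∷-injective e))) , refl
  split-at-zero-map⁻ (v ∷ V) (c ∷ T) y e with split-at-zero-map⁻ V T y (proj₂ (∷-injective e))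
  ... | t , y' , e₁ , e₂ = v ∷ t , y' , cong (v ∷_) e₁ , cong₂ _∷_ (proj₁ (∷-injective e)) e₂

  framed-map⁻ : ∀ V T → Framed T (map f V) → ∃ λ t → map f t ≡ T × Framed t V
  framed-map⁻ V T (x , y , e) = go V x (sym e)
    where
    go : ∀ V x → map f V ≡ x ++ 0 ∷ T ++ 0 ∷ y → ∃ λ t → map f t ≡ T × Framed t V
    go (v ∷ V) [] e with split-at-zero-map⁻ V T y (proj₂ (∷-injective e))
    ... | t , y' , e₁ , e₂ = t , e₂ , [] , y' , sym (cong₂ _∷_ (f⁻¹0 v (proj₁ (∷-injective e))) e₁)
    go (v ∷ V) (_ ∷ x) e with go V x (proj₂ (∷-injective e))
    ... | t , e₂ , x' , y' , e₁ = t , e₂ , v ∷ x' , y' , cong (v ∷_) e₁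

zeroFree-map⁻ : (f : ℕ → ℕ) → f 0 ≡ 0 → ∀ t → ZeroFree (map f t) → ZeroFree t
zeroFree-map⁻ f f0 t zf = All.map (λ fa≢0 a≡0 → fa≢0 (trans (cong f a≡0) f0)) (map⁻ zf)

nth-map : (f : ℕ → ℕ) → f 0 ≡ 0 → ∀ w n → nth (map f w) n ≡ f (nth w n)
nth-map f f0 [] n = sym f0
nth-map f f0 (a ∷ w) zero = refl
nth-map f f0 (a ∷ w) (suc n) = nth-map f f0 w n

nth-++ : ∀ w r n → n < length w → nth (w ++ r) n ≡ nth w n
nth-++ (a ∷ w) r zero _ = refl
nth-++ (a ∷ w) r (suc n) (s≤s n<w) = nth-++ w r n n<w

lookup≡nth : ∀ w (i : Fin (length w)) → lookup w i ≡ nth w (toℕ i)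
lookup≡nth (a ∷ w) fzero = refl
lookup≡nth (a ∷ w) (fsuc i) = lookup≡nth w i

prefixInf-from-nth : ∀ v u → (∀ n → n < length v → u n ≡ nth v n) → IsPrefixInf v u
prefixInf-from-nth v u agree i = trans (agree (toℕ i) (toℕ<n i)) (sym (lookup≡nth v i))

prefix-from-nth : ∀ v w → length w ≤ length v → (∀ (i : Fin (length w)) → nth v (toℕ i) ≡ lookup w i) →
  ∃ λ y → w ++ y ≡ v
prefix-from-nth v [] _ _ = v , refl
prefix-from-nth (a ∷ v) (c ∷ w) (s≤s w≤v) agree with prefix-from-nth v w w≤v (λ i → agree (fsuc i))
... | y , e = y , cong₂ _∷_ (sym (agree fzero)) e

factor-from-nth : ∀ v j w → j + length w ≤ length v → (∀ (i : Fin (length w)) → nth v (j + toℕ i) ≡ lookup w i) →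
  IsFactor w v
factor-from-nth v zero w fits agree with prefix-from-nth v w fits agree
... | y , e = [] , y , e
factor-from-nth (a ∷ v) (suc j) w (s≤s fits) agree with factor-from-nth v j w fits agree
... | x , y , e = a ∷ x , y , cong (a ∷_) e

module Folding (m p : ℕ) .{{_ : NonZero p}} where

  π : ℕ → ℕ
  π = dIndex m p

  π-< : ∀ n → n < m → π n ≡ n
  π-< n n<m with n <? m
  ... | yes _ = refl
  ... | no n≮m = contradiction n<m n≮m

  π-≥ : ∀ n → m ≤ n → π n ≡ m + (n ∸ m) % p
  π-≥ n m≤n with n <? m
  ... | yes n<m = contradiction n<m (≤⇒≯ m≤n)
  ... | no _ = refl

  π-bound : ∀ n → π n < m + p
  π-bound n with n <? m
  ... | yes n<m = <-≤-trans n<m (m≤m+n m p)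
  ... | no _ = +-monoʳ-< m (m%n<n (n ∸ m) p)

  π-fixed : ∀ ℓ → ℓ < m + p → π ℓ ≡ ℓ
  π-fixed ℓ ℓ<m+p with ℓ <? m
  ... | yes _ = refl
  ... | no ℓ≮m = trans (cong (m +_) (m<n⇒m%n≡m ℓ∸m<p)) (m+[n∸m]≡n m≤ℓ)
    where
    m≤ℓ : m ≤ ℓ
    m≤ℓ = ≮⇒≥ ℓ≮m
    ℓ∸m<p : ℓ ∸ m < p
    ℓ∸m<p = +-cancelˡ-< m (ℓ ∸ m) p (subst (_< m + p) (sym (m+[n∸m]≡n m≤ℓ)) ℓ<m+p)

  π-idem : ∀ n → π (π n) ≡ π n
  π-idem n = π-fixed (π n) (π-bound n)

  π-periodic : ∀ n → m ≤ n → π (n + p) ≡ π n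
  π-periodic n m≤n = begin
      π (n + p)              ≡⟨ π-≥ (n + p) (≤-trans m≤n (m≤m+n n p)) ⟩
      m + (n + p ∸ m) % p    ≡⟨ cong (λ z → m + z % p) (+-∸-comm p m≤n) ⟩
      m + (n ∸ m + p) % p    ≡⟨ cong (m +_) ([m+n]%n≡m%n (n ∸ m) p) ⟩
      m + (n ∸ m) % p        ≡⟨ sym (π-≥ n m≤n) ⟩
      π n                    ∎
    where open ≡-Reasoning

  π⁻¹0 : 1 ≤ m → ∀ a → π a ≡ 0 → a ≡ 0
  π⁻¹0 1≤m a πa≡0 with a <? m
  ... | yes _ = πa≡0
  ... | no _ = contradiction (≤-trans (m≤m+n m ((a ∸ m) % p)) (≤-reflexive πa≡0)) (<⇒≱ 1≤m)

  nextLetter-< : ∀ ℓ → suc ℓ < m + p → nextLetter m p ℓ ≡ suc ℓ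
  nextLetter-< ℓ lt with suc ℓ <? m + p
  ... | yes _ = refl
  ... | no ≮ = contradiction lt ≮

  nextLetter-≥ : ∀ ℓ → m + p ≤ suc ℓ → nextLetter m p ℓ ≡ m
  nextLetter-≥ ℓ ge with suc ℓ <? m + p
  ... | yes lt = contradiction lt (≤⇒≯ ge)
  ... | no _ = refl

  suc-%-reduce : ∀ n → suc n % p ≡ suc (n % p) % p
  suc-%-reduce n = trans (cong (λ z → suc z % p) (m≡m%n+[m/n]*n n p)) ([m+kn]%n≡m%n (suc (n % p)) (n / p) p)

  suc-% : ∀ n → (suc (n % p) < p × suc n % p ≡ suc (n % p)) ⊎ (suc (n % p) ≡ p × suc n % p ≡ 0)
  suc-% n with m≤n⇒m<n∨m≡n (m%n<n n p)
  ... | inj₁ lt = inj₁ (lt , trans (suc-%-reduce n) (m<n⇒m%n≡m lt))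
  ... | inj₂ eq = inj₂ (eq , trans (suc-%-reduce n) (trans (cong (_% p) eq) (n%n≡0 p)))

  π-suc : ∀ i → nextLetter m p (π i) ≡ π (suc i)
  π-suc i with m ≤? i
  ... | yes m≤i = begin
      nextLetter m p (π i)          ≡⟨ cong (nextLetter m p) (π-≥ i m≤i) ⟩
      nextLetter m p (m + r)        ≡⟨ step (suc-% (i ∸ m)) ⟩
      m + suc (i ∸ m) % p           ≡⟨ cong (λ z → m + z % p) (sym (+-∸-assoc 1 m≤i)) ⟩
      m + (suc i ∸ m) % p           ≡⟨ sym (π-≥ (suc i) (m≤n⇒m≤1+n m≤i)) ⟩
      π (suc i)                     ∎
    where
    open ≡-Reasoning
    r = (i ∸ m) % p
    step : (suc r < p × suc (i ∸ m) % p ≡ suc r) ⊎ (suc r ≡ p × suc (i ∸ m) % p ≡ 0) →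
           nextLetter m p (m + r) ≡ m + suc (i ∸ m) % p
    step (inj₁ (lt , e)) = trans (nextLetter-< (m + r) (subst (_< m + p) (+-suc m r) (+-monoʳ-< m lt)))
                             (trans (sym (+-suc m r)) (cong (m +_) (sym e)))
    step (inj₂ (eq , e)) = trans (nextLetter-≥ (m + r) (≤-reflexive (trans (cong (m +_) (sym eq)) (+-suc m r))))
                             (trans (sym (+-identityʳ m)) (cong (m +_) (sym e)))
  ... | no m≰i = trans (cong (nextLetter m p) (π-< i i<m)) (below (m≤n⇒m<n∨m≡n i<m))
    where
    i<m : i < m
    i<m = ≰⇒> m≰i
    below : suc i < m ⊎ suc i ≡ m → nextLetter m p i ≡ π (suc i)
    below (inj₁ 1+i<m) = trans (nextLetter-< i (<-≤-trans 1+i<m (m≤m+n m p))) (sym (π-< (suc i) 1+i<m))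
    below (inj₂ 1+i≡m) = trans (nextLetter-< i 1+i<m+p) (sym (π-fixed (suc i) 1+i<m+p))
      where
      1+i<m+p : suc i < m + p
      1+i<m+p = subst (_< m + p) (sym 1+i≡m) (m<m+n m (>-nonZero⁻¹ p))

  π-suc-cong : ∀ {a b} → π a ≡ π b → π (suc a) ≡ π (suc b)
  π-suc-cong {a} {b} e = trans (sym (π-suc a)) (trans (cong (nextLetter m p) e) (π-suc b))

  π-shift : ∀ {a b} → π a ≡ π b → ∀ o → π (a + o) ≡ π (b + o)
  π-shift {a} {b} e zero = trans (cong π (+-identityʳ a)) (trans e (cong π (sym (+-identityʳ b))))
  π-shift {a} {b} e (suc o) =
    trans (cong π (+-suc a o)) (trans (π-suc-cong (π-shift e o)) (cong π (sym (+-suc b o))))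

module Unfolded (d : ℕ → ℕ) where

  ψ : ℕ → Word
  ψ i = replicate (d i) 0 ++ (suc i ∷ [])

  ψ* : Word → Word
  ψ* = concatMap ψ

  ψ^ : ℕ → Word → Word
  ψ^ zero w = w
  ψ^ (suc k) w = ψ* (ψ^ k w)

  X : ℕ → Word
  X k = ψ^ k (0 ∷ [])

  P : ℕ → ℕ → Word
  P k j = ψ^ k (j ∷ [])

  rep : ℕ → Word → Word
  rep zero w = []
  rep (suc n) w = w ++ rep n w

  ψ^-++ : ∀ k u v → ψ^ k (u ++ v) ≡ ψ^ k u ++ ψ^ k v
  ψ^-++ zero u v = refl
  ψ^-++ (suc k) u v = trans (cong ψ* (ψ^-++ k u v)) (concatMap-++ ψ (ψ^ k u) (ψ^ k v))

  ψ^-+ : ∀ a b w → ψ^ a (ψ^ b w) ≡ ψ^ (a + b) w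
  ψ^-+ zero b w = refl
  ψ^-+ (suc a) b w = cong ψ* (ψ^-+ a b w)

  ψ^-suc : ∀ k w → ψ^ (suc k) w ≡ ψ^ k (ψ* w)
  ψ^-suc zero w = refl
  ψ^-suc (suc k) w = cong ψ* (ψ^-suc k w)

  ψ^-[] : ∀ k → ψ^ k [] ≡ []
  ψ^-[] zero = refl
  ψ^-[] (suc k) = cong ψ* (ψ^-[] k)

  ψ^-zeros : ∀ k n → ψ^ k (replicate n 0) ≡ rep n (X k)
  ψ^-zeros k zero = ψ^-[] k
  ψ^-zeros k (suc n) = trans (ψ^-++ k (0 ∷ []) (replicate n 0)) (cong (X k ++_) (ψ^-zeros k n))

  P-unfold : ∀ k j → P (suc k) j ≡ rep (d j) (X k) ++ P k (suc j)
  P-unfold k j = begin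
      P (suc k) j                                     ≡⟨ ψ^-suc k (j ∷ []) ⟩
      ψ^ k (ψ j ++ [])                                ≡⟨ cong (ψ^ k) (++-identityʳ (ψ j)) ⟩
      ψ^ k (replicate (d j) 0 ++ (suc j ∷ []))        ≡⟨ ψ^-++ k (replicate (d j) 0) (suc j ∷ []) ⟩
      ψ^ k (replicate (d j) 0) ++ P k (suc j)         ≡⟨ cong (_++ P k (suc j)) (ψ^-zeros k (d j)) ⟩
      rep (d j) (X k) ++ P k (suc j)                  ∎
    where open ≡-Reasoning

  P-unfold-pos : ∀ k j n → d j ≡ suc n → P (suc k) j ≡ X k ++ rep n (X k) ++ P k (suc j)
  P-unfold-pos k j n dj = trans (P-unfold k j)
    (trans (cong (λ v → rep v (X k) ++ P k (suc j)) dj) (++-assoc (X k) (rep n (X k)) (P k (suc j))))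

  P-unfold-zero : ∀ k j → d j ≡ 0 → P (suc k) j ≡ P k (suc j)
  P-unfold-zero k j dj = trans (P-unfold k j) (cong (λ v → rep v (X k) ++ P k (suc j)) dj)

  rep-snoc : ∀ n w → rep (suc n) w ≡ rep n w ++ w
  rep-snoc zero w = ++-identityʳ w
  rep-snoc (suc n) w = trans (cong (w ++_) (rep-snoc n w)) (sym (++-assoc w (rep n w) w))

  P-last : ∀ k j → ∃ λ W → P k j ≡ W ++ (j + k ∷ [])
  P-last zero j = [] , cong (_∷ []) (sym (+-identityʳ j))
  P-last (suc k) j with P-last k (suc j)
  ... | W , e = rep (d j) (X k) ++ W , (begin
      P (suc k) j                                  ≡⟨ P-unfold k j ⟩
      rep (d j) (X k) ++ P k (suc j)               ≡⟨ cong (rep (d j) (X k) ++_) e ⟩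
      rep (d j) (X k) ++ W ++ (suc j + k ∷ [])     ≡⟨ sym (++-assoc (rep (d j) (X k)) W _) ⟩
      (rep (d j) (X k) ++ W) ++ (suc j + k ∷ [])   ≡⟨ cong (λ z → (rep (d j) (X k) ++ W) ++ (z ∷ [])) (sym (+-suc j k)) ⟩
      (rep (d j) (X k) ++ W) ++ (j + suc k ∷ [])   ∎)
    where open ≡-Reasoning

  P-nonempty : ∀ k j → 1 ≤ length (P k j)
  P-nonempty k j with P-last k j
  ... | W , e = subst (λ w → 1 ≤ length w) (sym e)
                  (subst (1 ≤_) (sym (length-++ W)) (m≤n+m 1 (length W)))

  P-suffix : ∀ k j → ∃ λ V → X (k + j) ≡ V ++ P k j
  P-suffix k j with P-last j 0
  ... | W , e = ψ^ k W , (begin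
      X (k + j)              ≡⟨ sym (ψ^-+ k j (0 ∷ [])) ⟩
      ψ^ k (X j)             ≡⟨ cong (ψ^ k) e ⟩
      ψ^ k (W ++ (j ∷ []))   ≡⟨ ψ^-++ k W (j ∷ []) ⟩
      ψ^ k W ++ P k j        ∎)
    where open ≡-Reasoning

  P-letter : ∀ g j → (∀ o → o < g → d (j + o) ≡ 0) → P g j ≡ (j + g ∷ [])
  P-letter zero j _ = cong (_∷ []) (sym (+-identityʳ j))
  P-letter (suc g) j zeros = begin
      P (suc g) j           ≡⟨ P-unfold-zero g j (trans (cong d (sym (+-identityʳ j))) (zeros 0 (s≤s z≤n))) ⟩
      P g (suc j)           ≡⟨ P-letter g (suc j) (λ o o<g → trans (cong d (sym (+-suc j o))) (zeros (suc o) (s≤s o<g))) ⟩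
      (suc j + g ∷ [])      ≡⟨ cong (_∷ []) (sym (+-suc j g)) ⟩
      (j + suc g ∷ [])      ∎
    where open ≡-Reasoning

  P-0∷⇒nonzero : ∀ k j → StartsWith0 (P k (suc j)) → ∃ λ o → o < k × 1 ≤ d (suc j + o)
  P-0∷⇒nonzero zero j (r , ())
  P-0∷⇒nonzero (suc k) j st with d (suc j) in dj
  ... | suc _ = 0 , s≤s z≤n , subst (λ i → 1 ≤ d i) (sym (+-identityʳ (suc j))) (≤-trans (s≤s z≤n) (≤-reflexive (sym dj)))
  ... | zero with P-0∷⇒nonzero k (suc j) (subst StartsWith0 (P-unfold-zero k (suc j) dj) st)
  ...   | o , o<k , nz = suc o , s≤s o<k , subst (λ i → 1 ≤ d i) (sym (+-suc (suc j) o)) nz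

  Gap : ℕ → ℕ → Set
  Gap i g = 1 ≤ d i × (∀ o → o < g → d (suc i + o) ≡ 0)

  last-gap : ∀ k i → i < k → 1 ≤ d i → ∃ λ i* → ∃ λ g → i ≤ i* × i* + suc g ≡ k × Gap i* g
  last-gap (suc k) i i<1+k nz with d k in dk
  ... | suc _ = k , 0 , ≤-pred i<1+k , +-comm k 1 , (≤-trans (s≤s z≤n) (≤-reflexive (sym dk)) , λ _ ())
  ... | zero with m≤n⇒m<n∨m≡n (≤-pred i<1+k)
  ...   | inj₂ refl = contradiction (≤-trans nz (≤-reflexive dk)) λ ()
  ...   | inj₁ i<k with last-gap k i i<k nz
  ...     | i* , g , i≤i* , e , nz* , zeros = i* , suc g , i≤i* , trans (+-suc i* (suc g)) (cong suc e) , nz* , zeros'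
    where
    zeros' : ∀ o → o < suc g → d (suc i* + o) ≡ 0
    zeros' o o<1+g with m≤n⇒m<n∨m≡n (≤-pred o<1+g)
    ... | inj₁ o<g = zeros o o<g
    ... | inj₂ refl = trans (cong d (trans (sym (+-suc i* o)) e)) dk

  X-after-gap : ∀ i g xg tg → Gap i g → X g ≡ xg ++ 0 ∷ tg →
    ∃ λ V → X (i + suc g) ≡ V ++ 0 ∷ tg ++ (i + suc g ∷ [])
  X-after-gap i g xg tg (nz , zeros) eg with P-last i 0 | pos⇒suc nz
  ... | W , eW | n , di = ψ^ (suc g) W ++ rep n (X g) ++ xg , (begin
      X (i + suc g)                                         ≡⟨ cong X (+-comm i (suc g)) ⟩
      X (suc g + i)                                         ≡⟨ sym (ψ^-+ (suc g) i (0 ∷ [])) ⟩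
      ψ^ (suc g) (X i)                                      ≡⟨ cong (ψ^ (suc g)) eW ⟩
      ψ^ (suc g) (W ++ (i ∷ []))                            ≡⟨ ψ^-++ (suc g) W (i ∷ []) ⟩
      ψ^ (suc g) W ++ P (suc g) i                           ≡⟨ cong (ψ^ (suc g) W ++_) (P-unfold g i) ⟩
      ψ^ (suc g) W ++ rep (d i) (X g) ++ P g (suc i)        ≡⟨ cong (λ v → ψ^ (suc g) W ++ rep v (X g) ++ P g (suc i)) di ⟩
      ψ^ (suc g) W ++ rep (suc n) (X g) ++ P g (suc i)      ≡⟨ cong₂ (λ u v → ψ^ (suc g) W ++ u ++ v) (rep-snoc n (X g)) (P-letter g (suc i) zeros) ⟩
      ψ^ (suc g) W ++ (rep n (X g) ++ X g) ++ (c ∷ [])      ≡⟨ cong (λ z → ψ^ (suc g) W ++ (rep n (X g) ++ z) ++ (c ∷ [])) eg ⟩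
      ψ^ (suc g) W ++ (rep n (X g) ++ xg ++ 0 ∷ tg) ++ (c ∷ [])  ≡⟨ reassoc (ψ^ (suc g) W) (rep n (X g)) xg ⟩
      (ψ^ (suc g) W ++ rep n (X g) ++ xg) ++ 0 ∷ tg ++ (c ∷ [])  ≡⟨ cong (λ z → (ψ^ (suc g) W ++ rep n (X g) ++ xg) ++ 0 ∷ tg ++ (z ∷ [])) (sym (+-suc i g)) ⟩
      (ψ^ (suc g) W ++ rep n (X g) ++ xg) ++ 0 ∷ tg ++ (i + suc g ∷ []) ∎)
    where
    open ≡-Reasoning
    c = suc i + g
    reassoc : ∀ a b x → a ++ (b ++ x ++ 0 ∷ tg) ++ (c ∷ []) ≡ (a ++ b ++ x) ++ 0 ∷ tg ++ (c ∷ [])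
    reassoc a b x = trans (cong (a ++_) (trans (++-assoc b (x ++ 0 ∷ tg) (c ∷ [])) (cong (b ++_) (++-assoc x (0 ∷ tg) (c ∷ [])))))
                          (sym (trans (++-assoc a (b ++ x) (0 ∷ tg ++ (c ∷ []))) (cong (a ++_) (++-assoc b x (0 ∷ tg ++ (c ∷ []))))))

  module Prefixes (d0 : 1 ≤ d 0) where

    X-step : ∀ k → ∃ λ r → X (suc k) ≡ X k ++ r × 1 ≤ length r
    X-step k with pos⇒suc d0
    ... | n , d0≡ = rep n (X k) ++ P k 1 , P-unfold-pos k 0 n d0≡ ,
                    subst (1 ≤_) (sym (length-++ (rep n (X k)))) (≤-trans (P-nonempty k 1) (m≤n+m _ _))

    X-prefix : ∀ a b → a ≤ b → ∃ λ r → X b ≡ X a ++ r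
    X-prefix a b a≤b with m≤n⇒m<n∨m≡n a≤b
    ... | inj₂ refl = [] , sym (++-identityʳ (X a))
    X-prefix a (suc b) _ | inj₁ (s≤s a≤b) with X-prefix a b a≤b | X-step b
    ... | r , e | r' , e' , _ = r ++ r' , trans e' (trans (cong (_++ r') e) (++-assoc (X a) r r'))

    X-0∷ : ∀ k → StartsWith0 (X k)
    X-0∷ k = X-prefix 0 k z≤n

    X-length : ∀ k → suc k ≤ length (X k)
    X-length zero = s≤s z≤n
    X-length (suc k) with X-step k
    ... | r , e , 1≤r = subst (λ w → suc (suc k) ≤ length w) (sym e)
          (subst (suc (suc k) ≤_) (sym (length-++ (X k)))
            (subst (_≤ length (X k) + length r) (+-comm (suc k) 1) (+-mono-≤ (X-length k) 1≤r)))

    rep-0∷ : ∀ n k B → StartsWith0 (rep (suc n) (X k) ++ B)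
    rep-0∷ n k B = subst StartsWith0 (sym (++-assoc (X k) (rep n (X k)) B)) (startsWith0-++ (X k) _ (X-0∷ k))

    P-0∷-pos : ∀ k j n → d j ≡ suc n → StartsWith0 (P (suc k) j)
    P-0∷-pos k j n dj = subst StartsWith0 (sym (P-unfold-pos k j n dj))
                          (subst StartsWith0 (++-assoc (X k) (rep n (X k)) (P k (suc j))) (rep-0∷ n k (P k (suc j))))

    P-0∷ : ∀ k j o → o < k → 1 ≤ d (j + o) → StartsWith0 (P k j)
    P-0∷ (suc k) j o o<k nz with d j in dj
    ... | suc n = P-0∷-pos k j n dj
    P-0∷ (suc k) j zero _ nz | zero = contradiction (≤-trans nz (≤-reflexive (trans (cong d (+-identityʳ j)) dj))) λ ()
    P-0∷ (suc k) j (suc o) (s≤s o<k) nz | zero =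
      subst StartsWith0 (sym (P-unfold-zero k j dj)) (P-0∷ k (suc j) o o<k (subst (λ i → 1 ≤ d i) (+-suc j o) nz))

    P-shape : ∀ k j → StartsWith0 (P k j) ⊎ P k j ≡ (j + k ∷ [])
    P-shape zero j = inj₂ (cong (_∷ []) (sym (+-identityʳ j)))
    P-shape (suc k) j with d j in dj
    ... | suc n = inj₁ (P-0∷-pos k j n dj)
    ... | zero with P-shape k (suc j)
    ...   | inj₁ st = inj₁ (subst StartsWith0 (sym (P-unfold-zero k j dj)) st)
    ...   | inj₂ e = inj₂ (trans (P-unfold-zero k j dj) (trans e (cong (_∷ []) (sym (+-suc j k)))))

RnsCases : (d₀ m p h' R : ℕ) → Set
RnsCases d₀ m p h' R = (2 ≤ d₀ × R ≡ h' + p) ⊎ (d₀ ≤ 1 × R ≡ h' + m + p ∸ 1)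

Rns-spec : ∀ α m p h' → RnsCases (α 0) m p h' (Rns α m p h')
Rns-spec α m p h' with α 0
... | zero = inj₂ (z≤n , refl)
... | suc zero = inj₂ (s≤s z≤n , refl)
... | suc (suc _) = inj₁ (s≤s (s≤s z≤n) , refl)

module Parry (m p : ℕ) .{{_ : NonZero p}} (α : ℕ → ℕ) (1≤m : 1 ≤ m) where

  open Folding m p

  d : ℕ → ℕ
  d = dSeq α m p

  open Unfolded d

  π0 : π 0 ≡ 0
  π0 = π-< 0 1≤m

  -- d only depends on folded indices, so it agrees after indices with the same fold.
  d-after : ∀ {a b} → π a ≡ π b → ∀ o → d (suc a + o) ≡ d (suc b + o)
  d-after e o = cong α (π-shift (π-suc-cong e) o)

  gap-periodic : ∀ i g → m ≤ i → Gap (i + p) g → Gap i g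
  gap-periodic i g m≤i (nz , zeros) =
    subst (1 ≤_) (cong α (π-periodic i m≤i)) nz , λ o o<g → trans (d-after (sym (π-periodic i m≤i)) o) (zeros o o<g)

  ψ-folds : ∀ i → map π (ψ i) ≡ φ α m p (π i)
  ψ-folds i = begin
      map π (replicate (d i) 0 ++ (suc i ∷ []))           ≡⟨ map-++ π (replicate (d i) 0) (suc i ∷ []) ⟩
      map π (replicate (d i) 0) ++ (π (suc i) ∷ [])        ≡⟨ cong₂ (λ a b → a ++ (b ∷ []))
                                                               (trans (map-replicate π (d i) 0) (cong (replicate (d i)) π0))
                                                               (sym (π-suc i)) ⟩
      replicate (d i) 0 ++ (nextLetter m p (π i) ∷ [])     ∎
    where open ≡-Reasoning

  ψ*-folds : ∀ w → map π (ψ* w) ≡ φ* α m p (map π w)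
  ψ*-folds w = begin
      map π (concatMap ψ w)                        ≡⟨ map-concatMap π ψ w ⟩
      concatMap (λ i → map π (ψ i)) w              ≡⟨ concatMap-cong ψ-folds w ⟩
      concatMap (λ i → φ α m p (π i)) w            ≡⟨ sym (concatMap-map (φ α m p) π w) ⟩
      concatMap (φ α m p) (map π w)                ∎
    where open ≡-Reasoning

  ψ^-folds : ∀ k w → map π (ψ^ k w) ≡ φ^ α m p k (map π w)
  ψ^-folds zero w = refl
  ψ^-folds (suc k) w = trans (ψ*-folds (ψ^ k w)) (cong (φ* α m p) (ψ^-folds k w))

  φ^-X : ∀ k → φ^ α m p k (0 ∷ []) ≡ map π (X k)
  φ^-X k = sym (trans (ψ^-folds k (0 ∷ [])) (cong (λ z → φ^ α m p k (z ∷ [])) π0))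

  -- The Parry conditions force d₀ ≥ 1: a later nonzero value bounds d₀ from below.
  d0-positive : NonSimpleParry α m p → ∀ i → 1 ≤ i → 1 ≤ d i → 1 ≤ d 0
  d0-positive parry i 1≤i di with NonSimpleParry.shiftsSmaller parry i 1≤i
  ... | zero , _ , lt = ≤-trans (s≤s z≤n) lt
  ... | suc _ , agree , _ = subst (1 ≤_) (trans (cong d (sym (+-identityʳ i))) (agree 0 (s≤s z≤n))) di

  -- As d does not end in 0^ω, the first nonzero α_ℓ with ℓ ≥ m lies in the period.
  h'-in-period : NonSimpleParry α m p → ∀ h' → (∀ ℓ → m ≤ ℓ → ℓ < h' → α ℓ ≡ 0) → h' < m + p
  h'-in-period parry h' zeros with h' <? m + p
  ... | yes h'<m+p = h'<m+p
  ... | no h'≮m+p with NonSimpleParry.notEventuallyZero parry m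
  ...   | n , m≤n , dn≢0 = contradiction (zeros (π n) m≤πn (<-≤-trans (π-bound n) (≮⇒≥ h'≮m+p))) dn≢0
    where
    m≤πn : m ≤ π n
    m≤πn = subst (m ≤_) (sym (π-≥ n m≤n)) (m≤m+n m ((n ∸ m) % p))

  Rns-cases : ∀ h' → RnsCases (d 0) m p h' (Rns α m p h')
  Rns-cases h' = subst (λ a → RnsCases a m p h' (Rns α m p h')) (cong α (sym π0)) (Rns-spec α m p h')

  module Bound (d0 : 1 ≤ d 0) (h' : ℕ) (m≤h' : m ≤ h') (dh' : 1 ≤ d h') (R : ℕ)
               (R-spec : RnsCases (d 0) m p h' R) where

    open Prefixes d0

    h'-pred : ∃ λ o → h' ≡ suc o
    h'-pred = pos⇒suc (≤-trans 1≤m m≤h')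

    dh'+p : 1 ≤ d (h' + p)
    dh'+p = subst (1 ≤_) (cong α (sym (π-periodic h' m≤h'))) dh'

    R-when-d0≤1 : ¬ (2 ≤ d 0) → ∀ o → h' ≡ suc o → R ≡ o + m + p
    R-when-d0≤1 ¬2≤d0 o h'≡ = pick R-spec
      where
      pick : RnsCases (d 0) m p h' R → R ≡ o + m + p
      pick (inj₁ (2≤d0 , _)) = contradiction 2≤d0 ¬2≤d0
      pick (inj₂ (_ , R≡)) = trans R≡ (cong (λ z → z + m + p ∸ 1) h'≡)

    R-≥ : h' + p ≤ R
    R-≥ with 2 ≤? d 0 | h'-pred
    ... | yes 2≤d0 | _ = pick R-spec
      where
      pick : RnsCases (d 0) m p h' R → h' + p ≤ R
      pick (inj₁ (_ , R≡)) = ≤-reflexive (sym R≡)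
      pick (inj₂ (d0≤1 , _)) = contradiction (≤-trans 2≤d0 d0≤1) λ { (s≤s ()) }
    ... | no ¬2≤d0 | o , h'≡ = subst₂ _≤_ (cong (_+ p) (sym h'≡)) (sym (R-when-d0≤1 ¬2≤d0 o h'≡))
                                 (+-monoˡ-≤ p (subst (_≤ o + m) (+-comm o 1) (+-monoʳ-≤ o 1≤m)))

    h'≤R : h' ≤ R
    h'≤R = ≤-trans (m≤m+n h' p) R-≥

    R-small : ¬ (2 ≤ d 0) → ∀ k j → k < h' → j < m + p → suc k + j ≤ R
    R-small ¬2≤d0 k j k<h' j<m+p with h'-pred
    ... | o , h'≡ = subst (suc k + j ≤_) (sym (R-when-d0≤1 ¬2≤d0 o h'≡)) (begin
        suc k + j      ≡⟨ sym (+-suc k j) ⟩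
        k + suc j      ≤⟨ +-mono-≤ (≤-pred (subst (k <_) h'≡ k<h')) j<m+p ⟩
        o + (m + p)    ≡⟨ sym (+-assoc o m p) ⟩
        o + m + p      ∎)
      where open ≤-Reasoning

    W : Word
    W = X R ++ 0 ∷ []

    Good : Word → Set
    Good t = ∃ λ s → map π s ≡ map π t × Framed s W

    good-if-framed : ∀ k t → k ≤ R → Framed t (X k) → Good t
    good-if-framed k t k≤R fr with X-prefix k R k≤R
    ... | r , e = t , refl , framed-++ʳ (0 ∷ []) (subst (Framed t) (sym e) (framed-++ʳ r fr))

    -- Extends k j: in P_{k+1}(j) = X_k^{d_j} P_k(j+1) the first X_k is followed by 0.
    Extends : ℕ → ℕ → Set
    Extends k j = 1 ≤ d j × (2 ≤ d j ⊎ ∃ λ o → o < k × 1 ≤ d (suc j + o))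

    rest-0∷ : ∀ k j n → d j ≡ suc n → (2 ≤ d j ⊎ ∃ λ o → o < k × 1 ≤ d (suc j + o)) →
              StartsWith0 (rep n (X k) ++ P k (suc j))
    rest-0∷ k j (suc n) _ _ = rep-0∷ n k (P k (suc j))
    rest-0∷ k j zero _ (inj₂ (o , o<k , nz)) = P-0∷ k (suc j) o o<k nz
    rest-0∷ k j zero dj (inj₁ 2≤dj) = contradiction (≤-trans 2≤dj (≤-reflexive dj)) λ { (s≤s ()) }

    extends-prefix : ∀ k j → Extends k j → ∃ λ b → P (suc k) j ≡ X k ++ 0 ∷ b
    extends-prefix k j (nz , more) with pos⇒suc nz
    ... | n , dj with rest-0∷ k j n dj more
    ...   | r , e = r , trans (P-unfold-pos k j n dj) (cong (X k ++_) e)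

    extends-from-rest : ∀ k j n → suc n ≤ d j → StartsWith0 (rep n (X k) ++ P k (suc j)) → Extends k j
    extends-from-rest k j zero 1≤dj st = 1≤dj , inj₂ (P-0∷⇒nonzero k j st)
    extends-from-rest k j (suc n) 2+n≤dj _ = ≤-trans (s≤s z≤n) 2+n≤dj , inj₁ (≤-trans (s≤s (s≤s z≤n)) 2+n≤dj)

    -- Extends only depends on the fold of j, so j can be taken in the first period.
    extends-fold : ∀ {k j j'} → π j ≡ π j' → Extends k j → Extends k j'
    extends-fold e (nz , inj₁ 2≤dj) = subst (1 ≤_) (cong α e) nz , inj₁ (subst (2 ≤_) (cong α e) 2≤dj)
    extends-fold e (nz , inj₂ (o , o<k , nz')) = subst (1 ≤_) (cong α e) nz , inj₂ (o , o<k , subst (1 ≤_) (d-after e o) nz')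

    extends-small : ∀ {k j} → Extends k j → ∃ λ j' → j' < m + p × Extends k j'
    extends-small {j = j} ext = π j , π-bound j , extends-fold (sym (π-idem j)) ext

    extends-beyond-h' : ∀ k → h' ≤ k → Extends k 0
    extends-beyond-h' k h'≤k with h'-pred
    ... | o , h'≡ = d0 , inj₂ (o , subst (_≤ k) h'≡ h'≤k , subst (λ i → 1 ≤ d i) h'≡ dh')

    tail-framed : ∀ k j x t → Extends k j → X k ≡ x ++ 0 ∷ t → Framed t (X (suc k + j))
    tail-framed k j x t ext eX with extends-prefix k j ext | P-suffix (suc k) j
    ... | b , e | V , eV = subst (Framed t) (sym eV) (framed-++ˡ V (x , b , (begin
        x ++ 0 ∷ t ++ 0 ∷ b       ≡⟨ sym (++-assoc x (0 ∷ t) (0 ∷ b)) ⟩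
        (x ++ 0 ∷ t) ++ 0 ∷ b     ≡⟨ cong (_++ 0 ∷ b) (sym eX) ⟩
        X k ++ 0 ∷ b              ≡⟨ sym e ⟩
        P (suc k) j               ∎)))
      where open ≡-Reasoning

    good-if-extends : ∀ k j x t → suc k + j ≤ R → Extends k j → X k ≡ x ++ 0 ∷ t → Good t
    good-if-extends k j x t le ext eX = good-if-framed (suc k + j) t le (tail-framed k j x t ext eX)

    TailGood : ℕ → Set
    TailGood k = ∀ x t j → ZeroFree t → X k ≡ x ++ 0 ∷ t → Extends k j → Good t

    -- Levels k ≤ R: the tail is framed in X_{k+1+j} for a suitable j with k+1+j ≤ R.
    tail-good-≤R : ∀ k → k ≤ R → TailGood k
    tail-good-≤R k k≤R x t j zf eX ext with m≤n⇒m<n∨m≡n k≤R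
    ... | inj₂ refl = t , refl , x , [] , trans (sym (++-assoc x (0 ∷ t) (0 ∷ []))) (cong (_++ 0 ∷ []) (sym eX))
    ... | inj₁ k<R with 2 ≤? d 0 | h' ≤? k
    ...   | yes 2≤d0 | _ = good-if-extends k 0 x t (subst (_≤ R) (sym (+-identityʳ (suc k))) k<R) (d0 , inj₁ 2≤d0) eX
    ...   | no _ | yes h'≤k = good-if-extends k 0 x t (subst (_≤ R) (sym (+-identityʳ (suc k))) k<R) (extends-beyond-h' k h'≤k) eX
    ...   | no ¬2≤d0 | no h'≰k with extends-small ext
    ...     | j' , j'<m+p , ext' = good-if-extends k j' x t (R-small ¬2≤d0 k j' (≰⇒> h'≰k) j'<m+p) ext' eX

    -- Levels k > R: the tail of X_k has the π-image of the tail of X_{k-p}.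
    record Descent (k : ℕ) (t : Word) : Set where
      field
        k'         : ℕ
        x' t'      : Word
        smaller    : k' < k
        beyond-h'  : h' ≤ k'
        zeroFree   : ZeroFree t'
        tail       : X k' ≡ x' ++ 0 ∷ t'
        sameImage  : map π t' ≡ map π t

    +suc≢0 : ∀ a b → a + suc b ≢ 0
    +suc≢0 a b e with trans (sym (+-suc a b)) e
    ... | ()

    descend-from-gap : ∀ k x t i₀ g → ZeroFree t → X k ≡ x ++ 0 ∷ t →
                       (i₀ + p) + suc g ≡ k → h' ≤ i₀ → Gap (i₀ + p) g → Descent k t
    descend-from-gap k x t i₀ g zf eX ek h'≤i₀ gap with lastZero (X g) (X-0∷ g)
    ... | xg , tg , eg , zfg with X-after-gap (i₀ + p) g xg tg gap eg
                                | X-after-gap i₀ g xg tg (gap-periodic i₀ g (≤-trans m≤h' h'≤i₀) gap) eg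
    ... | V , eV | V₀ , eV₀ = record
      { k' = k₀ ; x' = V₀ ; t' = tg ++ (k₀ ∷ []) ; smaller = k₀<k ; beyond-h' = ≤-trans h'≤i₀ (m≤m+n i₀ (suc g))
      ; zeroFree = ++⁺ zfg (+suc≢0 i₀ g ∷ []) ; tail = eV₀ ; sameImage = sameImage }
      where
      open ≡-Reasoning
      k₀ : ℕ
      k₀ = i₀ + suc g
      k₀+p≡k : k₀ + p ≡ k
      k₀+p≡k = trans (trans (+-assoc i₀ (suc g) p) (trans (cong (i₀ +_) (+-comm (suc g) p)) (sym (+-assoc i₀ p (suc g))))) ek
      k₀<k : k₀ < k
      k₀<k = subst (k₀ <_) k₀+p≡k (m<m+n k₀ (>-nonZero⁻¹ p))
      t≡ : t ≡ tg ++ (k ∷ [])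
      t≡ = lastZero-unique x t V (tg ++ (k ∷ [])) (trans (sym eX) (subst (λ z → X z ≡ V ++ 0 ∷ tg ++ (z ∷ [])) ek eV))
             zf (++⁺ zfg ((λ k≡0 → +suc≢0 (i₀ + p) g (trans ek k≡0)) ∷ []))
      πk₀≡πk : π k₀ ≡ π k
      πk₀≡πk = trans (sym (π-periodic k₀ (≤-trans m≤h' (≤-trans h'≤i₀ (m≤m+n i₀ (suc g)))))) (cong π k₀+p≡k)
      sameImage : map π (tg ++ (k₀ ∷ [])) ≡ map π t
      sameImage = begin
        map π (tg ++ (k₀ ∷ []))     ≡⟨ map-++ π tg (k₀ ∷ []) ⟩
        map π tg ++ (π k₀ ∷ [])     ≡⟨ cong (λ z → map π tg ++ (z ∷ [])) πk₀≡πk ⟩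
        map π tg ++ (π k ∷ [])      ≡⟨ sym (map-++ π tg (k ∷ [])) ⟩
        map π (tg ++ (k ∷ []))      ≡⟨ cong (map π) (sym t≡) ⟩
        map π t                     ∎

    -- Beyond R, the last nonzero d_i below k (with i ≥ h' + p) supplies that gap.
    descend : ∀ k x t → R < k → ZeroFree t → X k ≡ x ++ 0 ∷ t → Descent k t
    descend k x t R<k zf eX with last-gap k (h' + p) (≤-<-trans R-≥ R<k) dh'+p
    ... | i , g , h'+p≤i , ek , gap =
      descend-from-gap k x t (i ∸ p) g zf eX (trans (cong (_+ suc g) i₀+p≡i) ek) h'≤i₀
                       (subst (λ z → Gap z g) (sym i₀+p≡i) gap)
      where
      i₀+p≡i : i ∸ p + p ≡ i
      i₀+p≡i = m∸n+n≡m (≤-trans (m≤n+m p h') h'+p≤i)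
      h'≤i₀ : h' ≤ i ∸ p
      h'≤i₀ = subst (_≤ i ∸ p) (m+n∸n≡m h' p) (∸-monoˡ-≤ p h'+p≤i)

    tail-good : ∀ k → TailGood k
    tail-good = <-rec TailGood step
      where
      step : ∀ k → (∀ {k'} → k' < k → TailGood k') → TailGood k
      step k rec x t j zf eX ext with k ≤? R
      ... | yes k≤R = tail-good-≤R k k≤R x t j zf eX ext
      ... | no k≰R = good-by-descent (descend k x t (≰⇒> k≰R) zf eX)
        where
        good-by-descent : Descent k t → Good t
        good-by-descent D with rec smaller x' t' 0 zeroFree tail (extends-beyond-h' k' beyond-h')
          where open Descent D
        ... | s , πs≡πt' , fr = s , trans πs≡πt' (Descent.sameImage D) , fr

    rest-0∷-if-0 : ∀ k j n t₂ y → rep n (X k) ++ P k (suc j) ≡ t₂ ++ 0 ∷ y → StartsWith0 (rep n (X k) ++ P k (suc j))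
    rest-0∷-if-0 k j (suc n) t₂ y _ = rep-0∷ n k (P k (suc j))
    rest-0∷-if-0 k j zero t₂ y e with P-shape k (suc j)
    ... | inj₁ st = st
    ... | inj₂ single = ⊥-elim (zero-∉-singleton t₂ y (suc j + k) (λ ()) (trans (sym e) single))

    crossing-good : ∀ k j n → suc n ≤ d j → ∀ x t₁ t₂ y → ZeroFree (t₁ ++ t₂) → X k ≡ x ++ 0 ∷ t₁ →
                    rep n (X k) ++ P k (suc j) ≡ t₂ ++ 0 ∷ y → Good (t₁ ++ t₂)
    crossing-good k j n 1+n≤dj x t₁ t₂ y zf eX eB with rest-0∷-if-0 k j n t₂ y eB
    ... | r , er = subst Good (sym t≡t₁) (tail-good k x t₁ j (subst ZeroFree t≡t₁ zf) eX (extends-from-rest k j n 1+n≤dj (r , er)))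
      where
      t≡t₁ : t₁ ++ t₂ ≡ t₁
      t≡t₁ = trans (cong (t₁ ++_) (zeroFree-before-leading-0 t₂ y r (++⁻ʳ t₁ zf) (trans (sym eB) er))) (++-identityʳ t₁)

    mutual
      framed-in-P-good : ∀ k j t → ZeroFree t → Framed t (P k j) → Good t
      framed-in-P-good zero j t zf (x , y , e) = ⊥-elim (framed-¬singleton x t y j e)
      framed-in-P-good (suc k) j t zf (x , y , e) = framed-in-blocks-good k j (d j) ≤-refl t zf (x , y , trans e (P-unfold k j))

      framed-in-blocks-good : ∀ k j n → n ≤ d j → ∀ t → ZeroFree t → Framed t (rep n (X k) ++ P k (suc j)) → Good t
      framed-in-blocks-good k j zero _ t zf fr = framed-in-P-good k (suc j) t zf fr
      framed-in-blocks-good k j (suc n) 1+n≤dj t zf (x , y , e)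
        with framed-++-cases x t y (X k) (rep n (X k) ++ P k (suc j)) (trans e (++-assoc (X k) (rep n (X k)) (P k (suc j))))
      ... | inj₁ fr = framed-in-P-good k 0 t zf fr
      ... | inj₂ (inj₁ fr) = framed-in-blocks-good k j n (≤-trans (n≤1+n n) 1+n≤dj) t zf fr
      ... | inj₂ (inj₂ (t₁ , t₂ , refl , eA , eB)) = crossing-good k j n 1+n≤dj x t₁ t₂ y zf eA eB

    W-image : φ^ α m p R (0 ∷ []) ++ (0 ∷ []) ≡ map π W
    W-image = trans (cong₂ _++_ (φ^-X R) (cong (_∷ []) (sym π0))) (sym (map-++ π (X R) (0 ∷ [])))

    W-prefix : ∀ N → R < N → ∃ λ r → X N ≡ W ++ r
    W-prefix N R<N with extends-prefix R 0 (extends-beyond-h' R h'≤R) | X-prefix (suc R) N R<N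
    ... | b , eb | r , er = b ++ r , trans er (trans (cong (_++ r) eb)
                              (trans (++-assoc (X R) (0 ∷ b) r) (sym (++-assoc (X R) (0 ∷ []) (b ++ r)))))

    fixedPoint-nth : ∀ n N → n < N → fixedPoint α m p n ≡ π (nth (X N) n)
    fixedPoint-nth n N n<N with X-prefix (suc n) N n<N
    ... | r , e = begin
        nth (φ^ α m p (suc n) (0 ∷ [])) n    ≡⟨ cong (λ w → nth w n) (φ^-X (suc n)) ⟩
        nth (map π (X (suc n))) n            ≡⟨ nth-map π π0 (X (suc n)) n ⟩
        π (nth (X (suc n)) n)                ≡⟨ cong π (sym (nth-++ (X (suc n)) r n (≤-trans (n≤1+n (suc n)) (X-length (suc n))))) ⟩
        π (nth (X (suc n) ++ r) n)           ≡⟨ cong (λ w → π (nth w n)) (sym e) ⟩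
        π (nth (X N) n)                      ∎
      where open ≡-Reasoning

    prefix-of-fixedPoint : IsPrefixInf (φ^ α m p R (0 ∷ []) ++ (0 ∷ [])) (fixedPoint α m p)
    prefix-of-fixedPoint = prefixInf-from-nth (φ^ α m p R (0 ∷ []) ++ (0 ∷ [])) (fixedPoint α m p) agree
      where
      agree : ∀ n → n < length (φ^ α m p R (0 ∷ []) ++ (0 ∷ [])) → fixedPoint α m p n ≡ nth (φ^ α m p R (0 ∷ []) ++ (0 ∷ [])) n
      agree n n<ℓ with W-prefix (suc n + R) (s≤s (m≤n+m R n))
      ... | r , e = begin
          fixedPoint α m p n           ≡⟨ fixedPoint-nth n (suc n + R) (s≤s (m≤m+n n R)) ⟩
          π (nth (X (suc n + R)) n)    ≡⟨ cong (λ w → π (nth w n)) e ⟩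
          π (nth (W ++ r) n)           ≡⟨ cong π (nth-++ W r n (subst (n <_) (trans (cong length W-image) (length-map π W)) n<ℓ)) ⟩
          π (nth W n)                  ≡⟨ sym (nth-map π π0 W n) ⟩
          nth (map π W) n              ≡⟨ cong (λ w → nth w n) (sym W-image) ⟩
          nth (φ^ α m p R (0 ∷ []) ++ (0 ∷ [])) n ∎
        where open ≡-Reasoning

    factor-of-some-X : ∀ w → IsFactorInf w (fixedPoint α m p) → ∃ λ N → IsFactor w (map π (X N))
    factor-of-some-X w (j , agree) = N , factor-from-nth (map π (X N)) j w fits agree'
      where
      N = j + length w
      fits : N ≤ length (map π (X N))
      fits = subst (N ≤_) (sym (length-map π (X N))) (≤-trans (n≤1+n N) (X-length N))
      agree' : ∀ i → nth (map π (X N)) (j + toℕ i) ≡ lookup w i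
      agree' i = trans (nth-map π π0 (X N) (j + toℕ i))
                   (trans (sym (fixedPoint-nth (j + toℕ i) N (+-monoʳ-< j (toℕ<n i)))) (agree i))

    -- Lift 0t0 to X_N, where it is good, and fold the witness back into φ^R(0)0.
    factors-in-prefix : ∀ t → ZeroFree t → IsFactorInf (0 ∷ t ++ 0 ∷ []) (fixedPoint α m p) →
                        IsFactor (0 ∷ t ++ 0 ∷ []) (φ^ α m p R (0 ∷ []) ++ (0 ∷ []))
    factors-in-prefix t zf occ with factor-of-some-X _ occ
    ... | N , fac with framed-map⁻ π (π⁻¹0 1≤m) (X N) t (factor⇒framed t _ fac)
    ... | t' , πt'≡t , fr with framed-in-P-good N 0 t' (zeroFree-map⁻ π π0 t' (subst ZeroFree (sym πt'≡t) zf)) fr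
    ... | s , πs≡πt' , frW = framed⇒factor t _ (subst₂ Framed (trans πs≡πt' πt'≡t) (sym W-image) (framed-map π π0 frW))

proposition4p7 : (m p : ℕ) → 1 ≤ m → .{{_ : NonZero p}} → (α : ℕ → ℕ) →
    NonSimpleParry α m p →
    (h' : ℕ) → m ≤ h' → 1 ≤ α h' → (∀ ℓ → m ≤ ℓ → ℓ < h' → α ℓ ≡ 0) →
    IsPrefixInf (φ^ α m p (Rns α m p h') (0 ∷ []) ++ (0 ∷ [])) (fixedPoint α m p)
    × ((t : List ℕ) → All (λ x → x ≢ 0) t →
       IsFactorInf (0 ∷ t ++ (0 ∷ [])) (fixedPoint α m p) →
       IsFactor (0 ∷ t ++ (0 ∷ [])) (φ^ α m p (Rns α m p h') (0 ∷ []) ++ (0 ∷ [])))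
proposition4p7 m p 1≤m α parry h' m≤h' αh'≥1 zeros = prefix-of-fixedPoint , factors-in-prefix
  where
  open Folding m p
  open Parry m p α 1≤m
  -- h' lies in the first period, so d_{h'} = α_{h'}.
  dh' : 1 ≤ d h'
  dh' = subst (1 ≤_) (cong α (sym (π-fixed h' (h'-in-period parry h' zeros)))) αh'≥1
  d0 : 1 ≤ d 0
  d0 = d0-positive parry h' (≤-trans 1≤m m≤h') dh'
  open Bound d0 h' m≤h' dh' (Rns α m p h') (Rns-cases h')
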